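{- If $\mathcal{G}$ is a star on $n\ge2$ vertices, a path on $n\ge2$ vertices, or a cycle on $n\ge3$ vertices, then $\lceil 2\sqrt{\theta_1(\mathcal{G})}\,\rceil\le\theta^{c}(\mathcal{G})\le 2\lceil\sqrt{\theta_1(\mathcal{G})}\,\rceil$.
   Context: Graphs are finite, simple and undirected. A star on $n$ vertices has one center adjacent to the other $n-1$ vertices and no other edges. For a graph $\mathcal{G}=(\mathcal{V},\mathcal{E})$ and positive integers $\alpha,\beta$, an $(\alpha\mid\beta)$-cointersection representation (CIR) of $\mathcal{G}$ consists of two disjoint finite sets of features $\mathcal{A},\mathcal{B}$ with $|\mathcal{A}|=\alpha$, $|\mathcal{B}|=\beta$, together with an assignment to each vertex $v$ of subsets $A_v\subseteq\mathcal{A}$, $B_v\subseteq\mathcal{B}$ (possibly empty), such that for all distinct $u,v\in\mathcal{V}$: $(u,v)\in\mathcal{E}$ if and only if $A_u\cap A_v\neq\varnothing$ and $B_u\cap B_v\neq\varnothing$. The cointersection number $\theta^{c}(\mathcal{G})$ is the minimum of $\alpha+\beta$ over all CIRs of $\mathcal{G}$. The intersection number $\theta_1(\mathcal{G})$ of a graph with at least one edge is the minimum number of cliques needed to cover all its edges. -}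

module Defs where

open import Data.Nat using (ℕ; zero; suc; _+_; _*_; _≤_; _∸_)
open import Data.Fin using (Fin; toℕ)
open import Data.Fin.Subset using (Subset; _∈_)
open import Data.Product using (_×_; ∃; ∃-syntax; Σ-syntax)
open import Data.Sum using (_⊎_)
open import Relation.Binary.PropositionalEquality using (_≡_; _≢_)

-- A graph on vertex set Fin n, given by its adjacency relation.
-- (The concrete graphs below are symmetric and irreflexive, i.e. simple.)
Graph : ℕ → Set₁
Graph n = Fin n → Fin n → Set

star : (n : ℕ) → Graph n
star n u v = (toℕ u ≡ 0 × toℕ v ≢ 0) ⊎ (toℕ v ≡ 0 × toℕ u ≢ 0)

path : (n : ℕ) → Graph n
path n u v = (toℕ v ≡ suc (toℕ u)) ⊎ (toℕ u ≡ suc (toℕ v))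

cycle : (n : ℕ) → Graph n
cycle n u v = path n u v
            ⊎ (toℕ u ≡ 0 × toℕ v ≡ n ∸ 1)
            ⊎ (toℕ v ≡ 0 × toℕ u ≡ n ∸ 1)

IsClique : ∀ {n} → Graph n → Subset n → Set
IsClique G C = ∀ u v → u ∈ C → v ∈ C → u ≢ v → G u v

EdgeCliqueCover : ∀ {n} → Graph n → ℕ → Set
EdgeCliqueCover {n} G k =
  Σ[ C ∈ (Fin k → Subset n) ] ((∀ (i : Fin k) → IsClique G (C i))
         × (∀ u v → G u v → ∃[ i ] (u ∈ C i × v ∈ C i)))

IsIntersectionNumber : ∀ {n} → Graph n → ℕ → Set
IsIntersectionNumber G t = EdgeCliqueCover G t × (∀ k → EdgeCliqueCover G k → t ≤ k)

-- An (α | β)-cointersection representation of G: feature sets Fin α and Fin β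
-- (disjoint by construction), subsets A_v ⊆ Fin α, B_v ⊆ Fin β, such that for
-- distinct u, v: adjacent iff A_u ∩ A_v ≠ ∅ and B_u ∩ B_v ≠ ∅.
CIR : ∀ {n} → Graph n → ℕ → ℕ → Set
CIR {n} G α β =
  Σ[ A ∈ (Fin n → Subset α) ] Σ[ B ∈ (Fin n → Subset β) ] (∀ (u v : Fin n) → u ≢ v →
     (G u v → (Σ[ a ∈ Fin α ] (a ∈ A u × a ∈ A v)) × (Σ[ b ∈ Fin β ] (b ∈ B u × b ∈ B v)))
   × ((Σ[ a ∈ Fin α ] (a ∈ A u × a ∈ A v)) × (Σ[ b ∈ Fin β ] (b ∈ B u × b ∈ B v)) → G u v))

HasCIRSize : ∀ {n} → Graph n → ℕ → Set
HasCIRSize G c = ∃[ α ] ∃[ β ] (1 ≤ α × 1 ≤ β × α + β ≡ c × CIR G α β)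

IsCointersectionNumber : ∀ {n} → Graph n → ℕ → Set
IsCointersectionNumber G c = HasCIRSize G c × (∀ d → HasCIRSize G d → c ≤ d)

-- s = ⌈√t⌉ : the least natural s with √t ≤ s, i.e. t ≤ s².
IsCeilSqrt : ℕ → ℕ → Set
IsCeilSqrt t s = t ≤ s * s × (∀ s' → t ≤ s' * s' → s ≤ s')

-- k = ⌈2√t⌉ : the least natural k with 2√t ≤ k, i.e. 4t ≤ k².
IsCeilTwoSqrt : ℕ → ℕ → Set
IsCeilTwoSqrt t k = 4 * t ≤ k * k × (∀ k' → 4 * t ≤ k' * k' → k ≤ k')

Bounds : ∀ {n} → Graph n → Set
Bounds G = ∃[ t ] ∃[ c ] (IsIntersectionNumber G t × IsCointersectionNumber G c
   × (∀ k → IsCeilTwoSqrt t k → k ≤ c)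
   × (∀ s → IsCeilSqrt t s → c ≤ 2 * s))

module Submission where

-- Lower bound (any loopless graph): the feature pairs (a , b) of an (α | β)-CIR span α·β
-- cliques covering all edges, so θ₁ ≤ αβ ≤ (α + β)²/4.  As ⌈2√t⌉ ≤ 2⌈√t⌉ always holds, it
-- then suffices to build, for t = θ₁(G), a CIR of size exactly k = ⌈2√t⌉ (lemma bounds);
-- we split k into halves α ≤ β ≤ α + 1, which satisfy t ≤ αβ (balancedSplit).
--
-- θ₁ is computed from an enumeration of the edges in which no clique contains two of
-- them: θ₁ is m for the star and path with m edges and n for the cycle Cₙ, n ≥ 4.  The
-- CIRs place the edges on distinct cells of the α × β board (Placement): a vertex gets the
-- rows and columns of its edges, which is a CIR as soon as edges with a common end are
-- collinear.  The leaves of a star get distinct cells, the edges of a path follow the snake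
-- tour of the board, and those of a cycle a closed row-by-row tour whose entry and exit
-- columns come from a 3-colouring of the rows (ClosedTour).  C₃ and C₄ are handled directly.

open import Defs
open import Data.Nat using (ℕ; zero; suc; pred; _+_; _*_; _∸_; _≤_; _<_; _≟_; _≤?_; z≤n; s≤s; s≤s⁻¹)
open import Data.Nat using (NonZero; >-nonZero; >-nonZero⁻¹)
open import Data.Nat.DivMod using (_/_; _%_; _mod_; m%n<n; m≡m%n+[m/n]*n; m<n*o⇒m/o<n; +-distrib-/-∣ʳ)
open import Data.Nat.DivMod using (m<n⇒m/n≡0; m*n/n≡m; [m+kn]%n≡m%n; m<n⇒m%n≡m; 0/n≡0)
open import Data.Nat.DivMod using (%-distribˡ-+; m%n%n≡m%n; n%n≡0)
open import Data.Nat.Divisibility using (divides-refl)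
open import Data.Nat.Properties
open import Data.Nat.Tactic.RingSolver using (solve-∀)
open import Data.Fin using (Fin; zero; suc; toℕ; fromℕ<; inject₁; inject≤; combine; remQuot) renaming (_≟_ to _≟ᶠ_)
open import Data.Fin.Properties using (remQuot-combine; combine-remQuot; toℕ-fromℕ<; toℕ-injective; toℕ<n; toℕ-inject₁;
                                       inject≤-injective; injective⇒≤; any?) renaming (suc-injective to fsuc-injective)
open import Data.Fin.Subset using (Subset; _∈_; _∪_; ⁅_⁆; ⊤)
open import Data.Fin.Subset.Properties using (_∈?_; x∈p∪q⁺; x∈p∪q⁻; x∈⁅x⁆; x∈⁅y⁆⇒x≡y; ∈⊤)
open import Data.Bool using (true)
open import Data.Vec using (tabulate)
open import Data.Vec.Properties using (lookup∘tabulate; []=⇒lookup; lookup⇒[]=)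
open import Data.Product using (Σ; _×_; _,_; proj₁; proj₂; ∃; ∃₂; uncurry)
open import Data.Product.Properties using (×-≡,≡→≡)
open import Data.Sum using (_⊎_; inj₁; inj₂; [_,_])
open import Data.Empty using (⊥-elim)
open import Function using (_∘_)
open import Relation.Nullary using (¬_; Dec; yes; no; does; contradiction)
open import Relation.Nullary.Decidable using (_×-dec_; _⊎-dec_; dec-true; from-no)
open import Relation.Unary using (Decidable)
open import Relation.Binary.Definitions using (tri<; tri≈; tri>)
open import Relation.Binary.PropositionalEquality hiding ([_])

select : ∀ {k} {P : Fin k → Set} → Decidable P → Subset k
select P? = tabulate (λ x → does (P? x))

∈-select⁺ : ∀ {k} {P : Fin k → Set} (P? : Decidable P) {x} → P x → x ∈ select P?
∈-select⁺ P? {x} px = lookup⇒[]= x _ (trans (lookup∘tabulate _ x) (dec-true (P? x) px))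

∈-select⁻ : ∀ {k} {P : Fin k → Set} (P? : Decidable P) {x} → x ∈ select P? → P x
∈-select⁻ P? {x} x∈ = witness (P? x) (trans (sym (lookup∘tabulate _ x)) ([]=⇒lookup x∈))
  where
  witness : ∀ {A : Set} (a? : Dec A) → does a? ≡ true → A
  witness (yes a) _ = a

Symmetric : ∀ {n} → Graph n → Set
Symmetric G = ∀ {u v} → G u v → G v u

Loopless : ∀ {n} → Graph n → Set
Loopless G = ∀ u → ¬ G u u

SharedFeatures : ∀ {n α β} → (Fin n → Subset α) → (Fin n → Subset β) → Fin n → Fin n → Set
SharedFeatures A B u v = (∃ λ a → a ∈ A u × a ∈ A v) × (∃ λ b → b ∈ B u × b ∈ B v)

-- Every pair of features (a , b) of a CIR spans a clique, namely the vertices carrying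
-- both a and b; these α·β cliques cover all edges, hence θ₁(G) ≤ α·β.
cir⇒cover : ∀ {n} {G : Graph n} {α β} → Loopless G → CIR G α β → EdgeCliqueCover G (α * β)
cir⇒cover {n} {G} {α} {β} loopless (A , B , rep) = clique , isClique , covers
  where
  Carries : Fin (α * β) → Fin n → Set
  Carries i v = proj₁ (remQuot {α} β i) ∈ A v × proj₂ (remQuot {α} β i) ∈ B v

  carries? : ∀ i → Decidable (Carries i)
  carries? i v = (_ ∈? A v) ×-dec (_ ∈? B v)

  clique : Fin (α * β) → Subset n
  clique i = select (carries? i)

  isClique : ∀ i → IsClique G (clique i)
  isClique i u v u∈ v∈ u≢v with ∈-select⁻ (carries? i) u∈ | ∈-select⁻ (carries? i) v∈
  ... | au , bu | av , bv = proj₂ (rep u v u≢v) ((_ , au , av) , (_ , bu , bv))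

  carries-pair : ∀ a b {v} → a ∈ A v → b ∈ B v → v ∈ clique (combine a b)
  carries-pair a b {v} a∈ b∈ = ∈-select⁺ (carries? (combine a b))
    (subst (λ ab → proj₁ ab ∈ A v × proj₂ ab ∈ B v) (sym (remQuot-combine a b)) (a∈ , b∈))

  covers : ∀ u v → G u v → ∃ λ i → u ∈ clique i × v ∈ clique i
  covers u v uv with proj₁ (rep u v (λ { refl → loopless u uv })) uv
  ... | (a , au , av) , (b , bu , bv) = combine a b , carries-pair a b au bu , carries-pair a b av bv

am-gm-ordered : ∀ {α β} → α ≤ β → 4 * (α * β) ≤ (α + β) * (α + β)
am-gm-ordered {α} {β} α≤β =
  subst (λ β → 4 * (α * β) ≤ (α + β) * (α + β)) (m+[n∸m]≡n α≤β)
        (subst (4 * (α * (α + d)) ≤_) (sym (square α d)) (m≤m+n _ (d * d)))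
  where
  d : ℕ
  d = β ∸ α
  square : ∀ a d → (a + (a + d)) * (a + (a + d)) ≡ 4 * (a * (a + d)) + d * d
  square = solve-∀

am-gm : ∀ α β → 4 * (α * β) ≤ (α + β) * (α + β)
am-gm α β with ≤-total α β
... | inj₁ α≤β = am-gm-ordered α≤β
... | inj₂ β≤α =
  subst₂ _≤_ (cong (4 *_) (*-comm β α)) (cong (λ s → s * s) (+-comm β α)) (am-gm-ordered β≤α)

-- Lower bound of the corollary: every CIR has size α + β ≥ ⌈2√θ₁⌉, as 4θ₁ ≤ 4αβ ≤ (α+β)².
ceilTwoSqrt≤size : ∀ {n} {G : Graph n} {t k α β} → IsIntersectionNumber G t → Loopless G →
                   IsCeilTwoSqrt t k → CIR G α β → k ≤ α + β
ceilTwoSqrt≤size {α = α} {β} (_ , θ₁-minimal) loopless (_ , k-minimal) cir =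
  k-minimal (α + β) (≤-trans (*-monoʳ-≤ 4 (θ₁-minimal _ (cir⇒cover loopless cir))) (am-gm α β))

Least : (ℕ → Set) → ℕ → Set
Least P k = P k × (∀ j → P j → k ≤ j)

least : ∀ {P : ℕ → Set} → Decidable P → ∀ {n} → P n → ∃ (Least P)
least {P} P? {n} pn = search 0 (λ _ ()) n (subst P (sym (+-identityʳ n)) pn)
  where
  search : ∀ k → (∀ j → j < k → ¬ P j) → ∀ d → P (d + k) → ∃ (Least P)
  search k below d p with P? k
  ... | yes pk = k , pk , λ j pj → ≮⇒≥ (λ j<k → below j j<k pj)
  search k below zero    p | no ¬pk = ⊥-elim (¬pk p)
  search k below (suc d) p | no ¬pk = search (suc k) below′ d (subst P (sym (+-suc d k)) p)
    where
    below′ : ∀ j → j < suc k → ¬ P j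
    below′ j j<1+k with m<1+n⇒m<n∨m≡n j<1+k
    ... | inj₁ j<k = below j j<k
    ... | inj₂ refl = ¬pk

-- ⌈2√t⌉ exists: it is the least k with 4t ≤ k², and k = 4t is a witness.
ceilTwoSqrt : ∀ t → ∃ (IsCeilTwoSqrt t)
ceilTwoSqrt t = least {P = λ k → 4 * t ≤ k * k} (λ k → 4 * t ≤? k * k) {4 * t} (m≤m*m (4 * t))
  where
  m≤m*m : ∀ m → m ≤ m * m
  m≤m*m zero    = z≤n
  m≤m*m (suc m) = m≤m*n (suc m) (suc m)

-- ⌈2√t⌉ ≤ 2⌈√t⌉, because 4t ≤ 4s² = (2s)².
ceilTwoSqrt≤2ceilSqrt : ∀ {t k s} → IsCeilTwoSqrt t k → IsCeilSqrt t s → k ≤ 2 * s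
ceilTwoSqrt≤2ceilSqrt {s = s} (_ , k-minimal) (t≤s² , _) =
  k-minimal (2 * s) (≤-trans (*-monoʳ-≤ 4 t≤s²) (≤-reflexive (square s)))
  where
  square : ∀ s → 4 * (s * s) ≡ (2 * s) * (2 * s)
  square = solve-∀

-- The corollary for a single graph: if θ₁(G) = t and G has a CIR of size ⌈2√t⌉,
-- then θᶜ(G) = ⌈2√t⌉, which lies between the two bounds.
bounds : ∀ {n} {G : Graph n} {t} → IsIntersectionNumber G t → Loopless G →
         (∀ {k} → IsCeilTwoSqrt t k → HasCIRSize G k) → Bounds G
bounds {G = G} {t} θ₁ loopless construct with ceilTwoSqrt t
... | k , ceil =
  t , k , θ₁ , (construct ceil , optimal)
    , (λ k′ ceil′ → proj₂ ceil′ k (proj₁ ceil))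
    , (λ s ceilSqrt → ceilTwoSqrt≤2ceilSqrt ceil ceilSqrt)
  where
  optimal : ∀ d → HasCIRSize G d → k ≤ d
  optimal d (α , β , _ , _ , refl , cir) = ceilTwoSqrt≤size θ₁ loopless ceil cir

halves : ∀ k → ∃ λ a → k ≡ a + a ⊎ k ≡ suc (a + a)
halves zero = 0 , inj₁ refl
halves (suc k) with halves k
... | a , inj₁ refl = a , inj₂ refl
... | a , inj₂ refl = suc a , inj₁ (cong suc (sym (+-suc a a)))

quarter : ∀ {t m} → 4 * t ≤ 4 * m + 1 → t ≤ m
quarter {t} {m} 4t≤4m+1 = ≮⇒≥ λ m<t →
  contradiction (+-cancelˡ-≤ (4 * m) 4 1 (begin
    4 * m + 4   ≡⟨ +-comm (4 * m) 4 ⟩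
    4 + 4 * m   ≡⟨ *-suc 4 m ⟨
    4 * suc m   ≤⟨ *-monoʳ-≤ 4 m<t ⟩
    4 * t       ≤⟨ 4t≤4m+1 ⟩
    4 * m + 1   ∎)) (λ { (s≤s ()) })
  where open ≤-Reasoning

record Split (t k : ℕ) : Set where
  field
    α β   : ℕ
    1≤α   : 1 ≤ α
    α≤β   : α ≤ β
    β≤1+α : β ≤ suc α
    α+β≡k : α + β ≡ k
    t≤αβ  : t ≤ α * β

  1≤β : 1 ≤ β
  1≤β = ≤-trans 1≤α α≤β

  β-nonZero : NonZero β
  β-nonZero = >-nonZero 1≤β

-- k = ⌈2√t⌉ splits in halves: 4t ≤ k² = 4αβ + (β − α)² ≤ 4αβ + 1 gives t ≤ αβ.
balancedSplit : ∀ {t k} → 1 ≤ t → IsCeilTwoSqrt t k → Split t k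
balancedSplit {t} {k} 1≤t (4t≤k² , _) with halves k
... | zero , inj₁ refl = contradiction (≤-trans (*-monoʳ-≤ 4 1≤t) 4t≤k²) λ ()
... | zero , inj₂ refl = contradiction (≤-trans (*-monoʳ-≤ 4 1≤t) 4t≤k²) λ { (s≤s ()) }
... | suc a , inj₁ refl = record
  { α = suc a ; β = suc a ; 1≤α = s≤s z≤n ; α≤β = ≤-refl ; β≤1+α = n≤1+n _ ; α+β≡k = refl
  ; t≤αβ = *-cancelˡ-≤ 4 (subst (4 * t ≤_) (even-square (suc a)) 4t≤k²) }
  where
  even-square : ∀ a → (a + a) * (a + a) ≡ 4 * (a * a)
  even-square = solve-∀
... | suc a , inj₂ refl = record
  { α = suc a ; β = suc (suc a) ; 1≤α = s≤s z≤n ; α≤β = n≤1+n _ ; β≤1+α = ≤-refl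
  ; α+β≡k = +-suc (suc a) (suc a)
  ; t≤αβ = quarter (subst (4 * t ≤_) (odd-square (suc a)) 4t≤k²) }
  where
  odd-square : ∀ a → suc (a + a) * suc (a + a) ≡ 4 * (a * suc a) + 1
  odd-square = solve-∀

fromSplit : ∀ {n} {G : Graph n} {t k} (s : Split t k) → CIR G (Split.α s) (Split.β s) → HasCIRSize G k
fromSplit s cir = α , β , 1≤α , 1≤β , α+β≡k , cir
  where open Split s

boundsBySplit : ∀ {n} {G : Graph n} {t} → 1 ≤ t → IsIntersectionNumber G t → Loopless G →
                (∀ {k} → IsCeilTwoSqrt t k → (s : Split t k) → CIR G (Split.α s) (Split.β s)) → Bounds G
boundsBySplit {G = G} {t} 1≤t θ₁ loopless represent = bounds θ₁ loopless construct
  where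
  construct : ∀ {k} → IsCeilTwoSqrt t k → HasCIRSize G k
  construct ceil = fromSplit (balancedSplit 1≤t ceil) (represent ceil (balancedSplit 1≤t ceil))

-- For n ≥ 5 the larger half β of k = ⌈2√n⌉ satisfies β ≥ 3 and β + 2 ≤ n; otherwise
-- k − 1 would already satisfy 4n ≤ (k − 1)², contradicting minimality of k.
cycleSplit : ∀ {n k} → 5 ≤ n → IsCeilTwoSqrt n k → ∀ {α β} → α ≤ β → β ≤ suc α → α + β ≡ k →
             3 ≤ β × β + 2 ≤ n
cycleSplit {n} {k} 5≤n (4n≤k² , minimal) {α} {β} α≤β β≤1+α α+β≡k = 3≤β , β+2≤n 3≤β β≤1+α α+β≡k
  where
  open ≤-Reasoning
  5≤k : 5 ≤ k
  5≤k = ≮⇒≥ λ k<5 → contradiction (begin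
    4 * 5   ≤⟨ *-monoʳ-≤ 4 5≤n ⟩
    4 * n   ≤⟨ 4n≤k² ⟩
    k * k   ≤⟨ *-mono-≤ (s≤s⁻¹ k<5) (s≤s⁻¹ k<5) ⟩
    4 * 4   ∎) (from-no (20 ≤? 16))

  3≤β : 3 ≤ β
  3≤β = ≮⇒≥ λ β<3 → contradiction (begin
    5       ≤⟨ 5≤k ⟩
    k       ≡⟨ α+β≡k ⟨
    α + β   ≤⟨ +-monoˡ-≤ β α≤β ⟩
    β + β   ≤⟨ +-mono-≤ (s≤s⁻¹ β<3) (s≤s⁻¹ β<3) ⟩
    4       ∎) (from-no (5 ≤? 4))

  β+2≤n : ∀ {β′} → 3 ≤ β′ → β′ ≤ suc α → α + β′ ≡ k → β′ + 2 ≤ n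
  β+2≤n {suc c} (s≤s 2≤c) (s≤s c≤α) α+β′≡k = ≮⇒≥ λ n<β+2 → k≰α+c (minimal (α + c) (begin
    4 * n              ≤⟨ *-monoʳ-≤ 4 (s≤s⁻¹ n<β+2) ⟩
    4 * (c + 2)        ≤⟨ *-monoʳ-≤ 4 c+2≤c*c ⟩
    4 * (c * c)        ≡⟨ square c ⟩
    (c + c) * (c + c)  ≤⟨ *-mono-≤ (+-monoˡ-≤ c c≤α) (+-monoˡ-≤ c c≤α) ⟩
    (α + c) * (α + c)  ∎))
    where
    square : ∀ c → 4 * (c * c) ≡ (c + c) * (c + c)
    square = solve-∀
    c+2≤c*c : c + 2 ≤ c * c
    c+2≤c*c = begin
      c + 2        ≤⟨ +-monoʳ-≤ c 2≤c ⟩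
      c + c        ≡⟨ cong (c +_) (+-identityʳ c) ⟨
      2 * c        ≤⟨ *-monoˡ-≤ c 2≤c ⟩
      c * c        ∎
    k≰α+c : ¬ k ≤ α + c
    k≰α+c k≤α+c = 1+n≰n (≤-trans (≤-reflexive (trans (sym (+-suc α c)) α+β′≡k)) k≤α+c)

-- A cell of the board ℕ × ℕ; the α × β board consists of the cells with row < α, column < β.
Cell : Set
Cell = ℕ × ℕ

row col : Cell → ℕ
row = proj₁
col = proj₂

cell-≡ : ∀ {c d : Cell} → row c ≡ row d → col c ≡ col d → c ≡ d
cell-≡ r k = ×-≡,≡→≡ (r , k)

Collinear : Cell → Cell → Set
Collinear c d = row c ≡ row d ⊎ col c ≡ col d

collinear-refl : ∀ c → Collinear c c
collinear-refl c = inj₁ refl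

collinear-sym : ∀ {c d} → Collinear c d → Collinear d c
collinear-sym (inj₁ r) = inj₁ (sym r)
collinear-sym (inj₂ k) = inj₂ (sym k)

Linked : (Cell → Set) → Set
Linked U = ∀ {c d} → U c → U d → Collinear c d

linked-meet : ∀ {U V : Cell → Set} → Linked U → Linked V → ∀ {c₁ c₂ c₃ c₄} →
              U c₁ → V c₂ → row c₁ ≡ row c₂ → U c₃ → V c₄ → col c₃ ≡ col c₄ → ∃ λ c → U c × V c
linked-meet {V = V} linkedU linkedV {c₁} {c₂} {c₃} {c₄} u₁ v₂ r₁₂ u₃ v₄ k₃₄ with row c₃ ≟ row c₄
... | yes r₃₄ = c₃ , u₃ , subst V (cell-≡ (sym r₃₄) (sym k₃₄)) v₄
... | no r₃≢r₄ with linkedU u₁ u₃ | linkedV v₂ v₄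
... | inj₁ r₁₃ | inj₁ r₂₄ = ⊥-elim (r₃≢r₄ (trans (sym r₁₃) (trans r₁₂ r₂₄)))
... | inj₁ r₁₃ | inj₂ k₂₄ = c₃ , u₃ , subst V (cell-≡ (trans (sym r₁₂) r₁₃) (trans k₂₄ (sym k₃₄))) v₂
... | inj₂ k₁₃ | inj₁ r₂₄ = c₁ , u₁ , subst V (cell-≡ (trans (sym r₂₄) (sym r₁₂)) (trans (sym k₃₄) (sym k₁₃))) v₄
... | inj₂ k₁₃ | inj₂ k₂₄ = c₁ , u₁ , subst V (cell-≡ (sym r₁₂) (trans k₂₄ (trans (sym k₃₄) (sym k₁₃)))) v₂

_∈ₑ_ : ∀ {n} → Fin n → Fin n × Fin n → Set
v ∈ₑ p = proj₁ p ≡ v ⊎ proj₂ p ≡ v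

_∈ₑ?_ : ∀ {n} (v : Fin n) p → Dec (v ∈ₑ p)
v ∈ₑ? p = (proj₁ p ≟ᶠ v) ⊎-dec (proj₂ p ≟ᶠ v)

record EdgeList {n} (G : Graph n) (m : ℕ) : Set where
  field
    edge   : Fin m → Fin n × Fin n
    joins  : ∀ e → G (proj₁ (edge e)) (proj₂ (edge e))
    listed : ∀ {u v} → G u v → ∃ λ e → u ∈ₑ edge e × v ∈ₑ edge e

module _ {n m} {G : Graph n} (symmetric : Symmetric G) (L : EdgeList G m) where
  open EdgeList L

  ends-adjacent : ∀ {e u v} → u ≢ v → u ∈ₑ edge e → v ∈ₑ edge e → G u v
  ends-adjacent u≢v (inj₁ refl) (inj₁ refl) = ⊥-elim (u≢v refl)
  ends-adjacent {e} _ (inj₁ refl) (inj₂ refl) = joins e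
  ends-adjacent {e} _ (inj₂ refl) (inj₁ refl) = symmetric (joins e)
  ends-adjacent u≢v (inj₂ refl) (inj₂ refl) = ⊥-elim (u≢v refl)

  edgeCover : EdgeCliqueCover G m
  edgeCover = pair , (λ e u v u∈ v∈ u≢v → ends-adjacent u≢v (∈pair⁻ u∈) (∈pair⁻ v∈)) , covers
    where
    pair : Fin m → Subset n
    pair e = ⁅ proj₁ (edge e) ⁆ ∪ ⁅ proj₂ (edge e) ⁆

    ∈pair⁻ : ∀ {e v} → v ∈ pair e → v ∈ₑ edge e
    ∈pair⁻ {e} v∈ with x∈p∪q⁻ ⁅ proj₁ (edge e) ⁆ _ v∈
    ... | inj₁ v∈₁ = inj₁ (sym (x∈⁅y⁆⇒x≡y _ v∈₁))
    ... | inj₂ v∈₂ = inj₂ (sym (x∈⁅y⁆⇒x≡y _ v∈₂))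

    ∈pair⁺ : ∀ {e v} → v ∈ₑ edge e → v ∈ pair e
    ∈pair⁺ (inj₁ refl) = x∈p∪q⁺ (inj₁ (x∈⁅x⁆ _))
    ∈pair⁺ (inj₂ refl) = x∈p∪q⁺ (inj₂ (x∈⁅x⁆ _))

    covers : ∀ u v → G u v → ∃ λ e → u ∈ pair e × v ∈ pair e
    covers u v uv with listed uv
    ... | e , u∈e , v∈e = e , ∈pair⁺ u∈e , ∈pair⁺ v∈e

  -- Listed edges e, e′ are separated by distinct non-adjacent ends x of e and y of e′;
  -- then no clique contains both edges.
  Separated : Fin m → Fin m → Set
  Separated e e′ = ∃₂ λ x y → x ∈ₑ edge e × y ∈ₑ edge e′ × x ≢ y × ¬ G x y

  separated-sym : ∀ {e e′} → Separated e e′ → Separated e′ e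
  separated-sym (x , y , x∈e , y∈e′ , x≢y , ¬xy) = y , x , y∈e′ , x∈e , x≢y ∘ sym , ¬xy ∘ symmetric

  separated⇒lower : (∀ {e e′} → e ≢ e′ → Separated e e′) → ∀ k → EdgeCliqueCover G k → m ≤ k
  separated⇒lower separated k (C , isClique , covers) = injective⇒≤ {f = cliqueOf} cliqueOf-injective
    where
    cliqueOf : Fin m → Fin k
    cliqueOf e = proj₁ (covers _ _ (joins e))

    inClique : ∀ e {v} → v ∈ₑ edge e → v ∈ C (cliqueOf e)
    inClique e (inj₁ refl) = proj₁ (proj₂ (covers _ _ (joins e)))
    inClique e (inj₂ refl) = proj₂ (proj₂ (covers _ _ (joins e)))

    cliqueOf-injective : ∀ {e e′} → cliqueOf e ≡ cliqueOf e′ → e ≡ e′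
    cliqueOf-injective {e} {e′} same with e ≟ᶠ e′
    ... | yes e≡e′ = e≡e′
    ... | no e≢e′ with separated e≢e′
    ... | x , y , x∈e , y∈e′ , x≢y , ¬xy =
      ⊥-elim (¬xy (isClique (cliqueOf e′) x y (subst (λ i → x ∈ C i) same (inClique e x∈e))
                                                (inClique e′ y∈e′) x≢y))

  separated⇒θ₁ : (∀ {e e′} → e ≢ e′ → Separated e e′) → IsIntersectionNumber G m
  separated⇒θ₁ separated = edgeCover , separated⇒lower separated

  -- Placing the listed edges on distinct cells of the α × β board so that edges with a
  -- common end are collinear yields an (α | β)-CIR: each vertex receives the rows and the
  -- columns of the cells of its edges.  By linked-meet, two vertices sharing a row and a
  -- column share a cell, hence an edge.
  module Placement {α β} (cell : Fin m → Cell) (onBoard : ∀ e → row (cell e) < α × col (cell e) < β)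
                   (injective : ∀ {e e′} → cell e ≡ cell e′ → e ≡ e′)
                   (collinear : ∀ {v e e′} → v ∈ₑ edge e → v ∈ₑ edge e′ → Collinear (cell e) (cell e′)) where

    inRow? : ∀ v → Decidable (λ (a : Fin α) → ∃ λ e → v ∈ₑ edge e × row (cell e) ≡ toℕ a)
    inRow? v a = any? (λ e → (v ∈ₑ? edge e) ×-dec (row (cell e) ≟ toℕ a))

    inCol? : ∀ v → Decidable (λ (b : Fin β) → ∃ λ e → v ∈ₑ edge e × col (cell e) ≡ toℕ b)
    inCol? v b = any? (λ e → (v ∈ₑ? edge e) ×-dec (col (cell e) ≟ toℕ b))

    rows : Fin n → Subset α
    rows v = select (inRow? v)

    cols : Fin n → Subset β
    cols v = select (inCol? v)

    rowAt : ∀ e {v} → v ∈ₑ edge e → fromℕ< (proj₁ (onBoard e)) ∈ rows v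
    rowAt e v∈e = ∈-select⁺ (inRow? _) (e , v∈e , sym (toℕ-fromℕ< _))

    colAt : ∀ e {v} → v ∈ₑ edge e → fromℕ< (proj₂ (onBoard e)) ∈ cols v
    colAt e v∈e = ∈-select⁺ (inCol? _) (e , v∈e , sym (toℕ-fromℕ< _))

    share : ∀ {u v} → G u v → SharedFeatures rows cols u v
    share uv with listed uv
    ... | e , u∈e , v∈e = (_ , rowAt e u∈e , rowAt e v∈e) , (_ , colAt e u∈e , colAt e v∈e)

    AtVertex : Fin n → Cell → Set
    AtVertex v c = ∃ λ e → v ∈ₑ edge e × cell e ≡ c

    linked : ∀ v → Linked (AtVertex v)
    linked v (e , v∈e , refl) (e′ , v∈e′ , refl) = collinear v∈e v∈e′

    adjacent : ∀ {u v} → u ≢ v → SharedFeatures rows cols u v → G u v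
    adjacent {u} {v} u≢v ((a , au , av) , (b , bu , bv))
      with ∈-select⁻ (inRow? u) au | ∈-select⁻ (inRow? v) av | ∈-select⁻ (inCol? u) bu | ∈-select⁻ (inCol? v) bv
    ... | e₁ , u∈e₁ , r₁ | e₂ , v∈e₂ , r₂ | e₃ , u∈e₃ , k₃ | e₄ , v∈e₄ , k₄
      with linked-meet (linked u) (linked v) (e₁ , u∈e₁ , refl) (e₂ , v∈e₂ , refl) (trans r₁ (sym r₂))
                                             (e₃ , u∈e₃ , refl) (e₄ , v∈e₄ , refl) (trans k₃ (sym k₄))
    ... | _ , (e , u∈e , refl) , (e′ , v∈e′ , same) =
      ends-adjacent u≢v u∈e (subst (λ f → v ∈ₑ edge f) (injective same) v∈e′)

    cir : CIR G α β
    cir = rows , cols , λ u v u≢v → share , adjacent u≢v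

record RookTour (α β m : ℕ) : Set where
  field
    cell     : ℕ → Cell
    onBoard  : ∀ {i} → i < m → row (cell i) < α × col (cell i) < β
    distinct : ∀ {i j} → i < m → j < m → cell i ≡ cell j → i ≡ j
    step     : ∀ {i} → suc i < m → Collinear (cell i) (cell (suc i))

Closed : ∀ {α β m} → RookTour α β m → Set
Closed {m = m} T = Collinear (RookTour.cell T (m ∸ 1)) (RookTour.cell T 0)

module RowMajor (β : ℕ) .{{_ : NonZero β}} where

  rowOf pos : ℕ → ℕ
  rowOf i = i / β
  pos i = i % β

  pos<β : ∀ i → pos i < β
  pos<β i = m%n<n i β

  rowOf< : ∀ {α i} → i < α * β → rowOf i < α
  rowOf< = m<n*o⇒m/o<n

  decompose : ∀ i → i ≡ pos i + rowOf i * β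
  decompose i = m≡m%n+[m/n]*n i β

  index-unique : ∀ {i j} → rowOf i ≡ rowOf j → pos i ≡ pos j → i ≡ j
  index-unique {i} {j} r p = trans (decompose i) (trans (cong₂ (λ p r → p + r * β) p r) (sym (decompose j)))

  coordinates : ∀ {p r} → p < β → rowOf (p + r * β) ≡ r × pos (p + r * β) ≡ p
  coordinates {p} {r} p<β =
    trans (+-distrib-/-∣ʳ p (divides-refl r)) (cong₂ _+_ (m<n⇒m/n≡0 p<β) (m*n/n≡m r β)) ,
    trans ([m+kn]%n≡m%n p r β) (m<n⇒m%n≡m p<β)

  origin : rowOf 0 ≡ 0 × pos 0 ≡ 0
  origin = 0/n≡0 β , m<n⇒m%n≡m (>-nonZero⁻¹ β)

  next-in-row : ∀ {i} → suc (pos i) < β → rowOf (suc i) ≡ rowOf i × pos (suc i) ≡ suc (pos i)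
  next-in-row {i} 1+p<β =
    subst (λ j → rowOf j ≡ rowOf i × pos j ≡ suc (pos i)) (sym (cong suc (decompose i)))
          (coordinates 1+p<β)

  next-row : ∀ {i} → suc (pos i) ≡ β → rowOf (suc i) ≡ suc (rowOf i) × pos (suc i) ≡ 0
  next-row {i} 1+p≡β =
    subst (λ j → rowOf j ≡ suc (rowOf i) × pos j ≡ 0) (sym 1+i≡)
          (coordinates {0} {suc (rowOf i)} (>-nonZero⁻¹ β))
    where
    1+i≡ : suc i ≡ 0 + suc (rowOf i) * β
    1+i≡ = trans (cong suc (decompose i)) (cong (_+ rowOf i * β) 1+p≡β)

  rowMajorTour : ∀ {α m} (column : ℕ → ℕ) → m ≤ α * β →
                 (∀ {i} → i < m → column i < β) →
                 (∀ {i j} → i < m → j < m → rowOf i ≡ rowOf j → column i ≡ column j → i ≡ j) →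
                 (∀ {i} → suc i < m → suc (pos i) ≡ β → column i ≡ column (suc i)) →
                 RookTour α β m
  rowMajorTour {α} {m} column m≤αβ column<β separates turns = record
    { cell     = λ i → rowOf i , column i
    ; onBoard  = λ i<m → rowOf< (≤-trans i<m m≤αβ) , column<β i<m
    ; distinct = λ i<m j<m same → separates i<m j<m (cong row same) (cong col same)
    ; step     = step
    }
    where
    step : ∀ {i} → suc i < m → Collinear (rowOf i , column i) (rowOf (suc i) , column (suc i))
    step {i} 1+i<m with m≤n⇒m<n∨m≡n (pos<β i)
    ... | inj₁ 1+p<β = inj₁ (sym (proj₁ (next-in-row 1+p<β)))
    ... | inj₂ 1+p≡β = inj₂ (turns 1+i<m 1+p≡β)

  snakeColumn : ℕ → ℕ → ℕ
  snakeColumn zero          p = p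
  snakeColumn (suc zero)    p = pred β ∸ p
  snakeColumn (suc (suc r)) p = snakeColumn r p

  snakeColumn<β : ∀ r {p} → p < β → snakeColumn r p < β
  snakeColumn<β zero          p<β = p<β
  snakeColumn<β (suc zero) {p} _ = m≤pred[n]⇒suc[m]≤n (m∸n≤m (pred β) p)
  snakeColumn<β (suc (suc r)) p<β = snakeColumn<β r p<β

  snakeColumn-injective : ∀ r {p q} → p < β → q < β → snakeColumn r p ≡ snakeColumn r q → p ≡ q
  snakeColumn-injective zero          _   _   same = same
  snakeColumn-injective (suc zero)    p<β q<β same = ∸-cancelˡ-≡ (<⇒≤pred p<β) (<⇒≤pred q<β) same
  snakeColumn-injective (suc (suc r)) p<β q<β same = snakeColumn-injective r p<β q<β same

  snakeColumn-turn : ∀ r → snakeColumn r (pred β) ≡ snakeColumn (suc r) 0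
  snakeColumn-turn zero          = refl
  snakeColumn-turn (suc zero)    = n∸n≡0 (pred β)
  snakeColumn-turn (suc (suc r)) = snakeColumn-turn r

  snake : ∀ {α m} → m ≤ α * β → RookTour α β m
  snake {α} {m} m≤αβ =
    rowMajorTour column m≤αβ (λ {i} _ → snakeColumn<β (rowOf i) (pos<β i)) separates turns
    where
    column : ℕ → ℕ
    column i = snakeColumn (rowOf i) (pos i)

    separates : ∀ {i j} → i < m → j < m → rowOf i ≡ rowOf j → column i ≡ column j → i ≡ j
    separates {i} {j} _ _ r same =
      index-unique r (snakeColumn-injective (rowOf j) (pos<β i) (pos<β j)
                        (subst (λ r → snakeColumn r (pos i) ≡ column j) r same))

    turns : ∀ {i} → suc i < m → suc (pos i) ≡ β → column i ≡ column (suc i)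
    turns {i} _ 1+p≡β = begin
      snakeColumn (rowOf i) (pos i)              ≡⟨ cong (snakeColumn (rowOf i)) (cong pred 1+p≡β) ⟩
      snakeColumn (rowOf i) (pred β)             ≡⟨ snakeColumn-turn (rowOf i) ⟩
      snakeColumn (suc (rowOf i)) 0              ≡⟨ cong₂ snakeColumn (sym (proj₁ next)) (sym (proj₂ next)) ⟩
      snakeColumn (rowOf (suc i)) (pos (suc i))  ∎
      where
      open ≡-Reasoning
      next : rowOf (suc i) ≡ suc (rowOf i) × pos (suc i) ≡ 0
      next = next-row {i} 1+p≡β

squareTour : Σ (RookTour 2 2 4) Closed
squareTour = snake ≤-refl , inj₂ refl
  where open RowMajor 2

alternate : ℕ → ℕ
alternate zero    = 0
alternate (suc r) = 1 ∸ alternate r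

alternate≤1 : ∀ r → alternate r ≤ 1
alternate≤1 zero    = z≤n
alternate≤1 (suc r) = m∸n≤m 1 (alternate r)

alternate-flips : ∀ r → alternate r ≢ alternate (suc r)
alternate-flips r = flips (alternate≤1 r)
  where
  flips : ∀ {a} → a ≤ 1 → a ≢ 1 ∸ a
  flips z≤n       = λ ()
  flips (s≤s z≤n) = λ ()

alternate-even : ∀ a → alternate (a + a) ≡ 0
alternate-even zero    = refl
alternate-even (suc a) rewrite +-suc a a | alternate-even a = refl

detour : ℕ → ℕ
detour zero                = 0
detour (suc zero)          = 1
detour (suc (suc zero))    = 2
detour (suc (suc (suc r))) = alternate r

detour≤2 : ∀ r → detour r ≤ 2
detour≤2 zero                = z≤n
detour≤2 (suc zero)          = s≤s z≤n
detour≤2 (suc (suc zero))    = ≤-refl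
detour≤2 (suc (suc (suc r))) = m≤n⇒m≤1+n (alternate≤1 r)

detour-flips : ∀ r → detour r ≢ detour (suc r)
detour-flips zero                = λ ()
detour-flips (suc zero)          = λ ()
detour-flips (suc (suc zero))    = λ ()
detour-flips (suc (suc (suc r))) = alternate-flips r

-- A colouring of the rows by the columns 0, 1, 2 in which neighbouring rows differ and the
-- rows 0 and L both get colour 0.
record RowColouring (L : ℕ) : Set where
  field
    colour   : ℕ → ℕ
    colour≤2 : ∀ r → colour r ≤ 2
    proper   : ∀ r → colour r ≢ colour (suc r)
    starts   : colour 0 ≡ 0
    returns  : colour L ≡ 0

rowColouring : ∀ L → L ≢ 1 → RowColouring L
rowColouring L L≢1 with halves L
... | a , inj₁ refl = record
  { colour = alternate ; colour≤2 = λ r → m≤n⇒m≤1+n (alternate≤1 r) ; proper = alternate-flips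
  ; starts = refl ; returns = alternate-even a }
... | zero , inj₂ refl = ⊥-elim (L≢1 refl)
... | suc a , inj₂ refl = record
  { colour = detour ; colour≤2 = detour≤2 ; proper = detour-flips
  ; starts = refl ; returns = trans (cong (λ m → detour (suc (suc m))) (+-suc a a)) (alternate-even a) }

third : ℕ → ℕ → ℕ
third a b = 3 ∸ (a + b)

third-spec : ∀ {a b} → a ≤ 2 → b ≤ 2 → a ≢ b → third a b ≢ a × third a b ≢ b × third a b ≤ 2
third-spec {0} {0} _ _ a≢b = ⊥-elim (a≢b refl)
third-spec {0} {1} _ _ _   = (λ ()) , (λ ()) , ≤-refl
third-spec {0} {2} _ _ _   = (λ ()) , (λ ()) , s≤s z≤n
third-spec {1} {0} _ _ _   = (λ ()) , (λ ()) , ≤-refl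
third-spec {1} {1} _ _ a≢b = ⊥-elim (a≢b refl)
third-spec {1} {2} _ _ _   = (λ ()) , (λ ()) , z≤n
third-spec {2} {0} _ _ _   = (λ ()) , (λ ()) , s≤s z≤n
third-spec {2} {1} _ _ _   = (λ ()) , (λ ()) , z≤n
third-spec {2} {2} _ _ a≢b = ⊥-elim (a≢b refl)
third-spec {suc (suc (suc _))} (s≤s (s≤s ())) _ _
third-spec {_} {suc (suc (suc _))} _ (s≤s (s≤s ())) _

rowColumn : ∀ {E : Set} → ℕ → ℕ → ℕ → Dec E → ℕ
rowColumn a b zero          _       = a
rowColumn a b (suc p)       (yes _) = b
rowColumn a b (suc zero)    (no _)  = third a b
rowColumn a b (suc (suc p)) (no _)  = 3 + p

data RowKind (a b p : ℕ) (E : Set) (c : ℕ) : Set where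
  entry  : p ≡ 0 → c ≡ a → RowKind a b p E c
  exit   : p ≢ 0 → E → c ≡ b → RowKind a b p E c
  second : p ≡ 1 → ¬ E → c ≡ third a b → RowKind a b p E c
  middle : 2 ≤ p → ¬ E → c ≡ suc p → RowKind a b p E c

rowKind : ∀ {E} a b p (e? : Dec E) → RowKind a b p E (rowColumn a b p e?)
rowKind a b zero          _        = entry refl refl
rowKind a b (suc p)       (yes e)  = exit (λ ()) e refl
rowKind a b (suc zero)    (no ¬e)  = second refl ¬e refl
rowKind a b (suc (suc p)) (no ¬e)  = middle (s≤s (s≤s z≤n)) ¬e refl

module _ {a b} (a≤2 : a ≤ 2) (b≤2 : b ≤ 2) (a≢b : a ≢ b) where
  private
    t : third a b ≢ a × third a b ≢ b × third a b ≤ 2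
    t = third-spec a≤2 b≤2 a≢b

    small≢big : ∀ {x p} → x ≤ 2 → 2 ≤ p → x ≢ suc p
    small≢big x≤2 2≤p refl = 1+n≰n (≤-trans (s≤s 2≤p) x≤2)

    small<β : ∀ {c x β} → c ≡ x → x ≤ 2 → 3 ≤ β → c < β
    small<β c≡x x≤2 3≤β = ≤-trans (s≤s (≤-trans (≤-reflexive c≡x) x≤2)) 3≤β

    values : ∀ {c d x y : ℕ} → c ≡ x → c ≡ d → d ≡ y → x ≡ y
    values c≡x c≡d d≡y = trans (sym c≡x) (trans c≡d d≡y)

  rowColumn<β : ∀ {E β p} (e? : Dec E) → 3 ≤ β → p < β → (suc p ≡ β → E) → rowColumn a b p e? < β
  rowColumn<β {p = p} e? 3≤β p<β last with rowKind a b p e?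
  ... | entry _ c≡a       = small<β c≡a a≤2 3≤β
  ... | exit _ _ c≡b      = small<β c≡b b≤2 3≤β
  ... | second _ _ c≡t    = small<β c≡t (proj₂ (proj₂ t)) 3≤β
  ... | middle _ ¬last c≡ = subst (_< _) (sym c≡) (≤∧≢⇒< p<β (¬last ∘ last))

  rowColumn-injective : ∀ {E F p q} (e? : Dec E) (f? : Dec F) →
                        rowColumn a b p e? ≡ rowColumn a b q f? → p ≡ q ⊎ (E × F)
  rowColumn-injective {p = p} {q} e? f? same with rowKind a b p e? | rowKind a b q f?
  ... | entry p≡0 _    | entry q≡0 _    = inj₁ (trans p≡0 (sym q≡0))
  ... | exit _ e _     | exit _ f _     = inj₂ (e , f)
  ... | second p≡1 _ _ | second q≡1 _ _ = inj₁ (trans p≡1 (sym q≡1))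
  ... | middle _ _ cp  | middle _ _ cq  = inj₁ (suc-injective (values cp same cq))
  ... | entry _ cp     | exit _ _ cq    = ⊥-elim (a≢b (values cp same cq))
  ... | entry _ cp     | second _ _ cq  = ⊥-elim (proj₁ t (sym (values cp same cq)))
  ... | entry _ cp     | middle 2≤q _ cq = ⊥-elim (small≢big a≤2 2≤q (values cp same cq))
  ... | exit _ _ cp    | entry _ cq     = ⊥-elim (a≢b (sym (values cp same cq)))
  ... | exit _ _ cp    | second _ _ cq  = ⊥-elim (proj₁ (proj₂ t) (sym (values cp same cq)))
  ... | exit _ _ cp    | middle 2≤q _ cq = ⊥-elim (small≢big b≤2 2≤q (values cp same cq))
  ... | second _ _ cp  | entry _ cq     = ⊥-elim (proj₁ t (values cp same cq))
  ... | second _ _ cp  | exit _ _ cq    = ⊥-elim (proj₁ (proj₂ t) (values cp same cq))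
  ... | second _ _ cp  | middle 2≤q _ cq = ⊥-elim (small≢big (proj₂ (proj₂ t)) 2≤q (values cp same cq))
  ... | middle 2≤p _ cp | entry _ cq    = ⊥-elim (small≢big a≤2 2≤p (sym (values cp same cq)))
  ... | middle 2≤p _ cp | exit _ _ cq   = ⊥-elim (small≢big b≤2 2≤p (sym (values cp same cq)))
  ... | middle 2≤p _ cp | second _ _ cq = ⊥-elim (small≢big (proj₂ (proj₂ t)) 2≤p (sym (values cp same cq)))

-- The row whose entry column the last cell of a tour ending at position p of row r uses:
-- r itself if the tour ends at the start of row r, and the next row otherwise.
closingRow : ℕ → ℕ → ℕ
closingRow r zero    = r
closingRow r (suc _) = suc r

-- The cells are visited in row-major order, row r being entered in column x r and left in
-- column x (r + 1), for a row colouring x (rowColumn).  The last cell lies in column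
-- x L = 0 with L the closing row, so it is collinear with the first cell (0 , 0).
module ClosedTour (α β n : ℕ) .{{_ : NonZero β}}
                  (3≤β : 3 ≤ β) (β+2≤n : β + 2 ≤ n) (n≤αβ : n ≤ α * β) where
  open RowMajor β

  last : ℕ
  last = n ∸ 1

  n≡1+last : n ≡ suc last
  n≡1+last = sym (m+[n∸m]≡n (≤-trans (s≤s z≤n) (≤-trans (m≤n+m 2 β) β+2≤n)))

  -- A tour of β + 1 cells ends at the start of row 1, and a tour of at most β cells ends in
  -- row 0; both are excluded by β + 2 ≤ n.
  closingRow≢1 : ∀ r p → p < β → last ≡ p + r * β → closingRow r p ≢ 1
  closingRow≢1 r zero _ last≡ refl = 1+n≰n (begin
    suc (β + 1)   ≡⟨ +-suc β 1 ⟨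
    β + 2         ≤⟨ β+2≤n ⟩
    n             ≡⟨ trans n≡1+last (cong suc last≡) ⟩
    suc (β + 0)   ≡⟨ cong suc (+-identityʳ β) ⟩
    suc β         ≡⟨ +-comm 1 β ⟩
    β + 1         ∎)
    where open ≤-Reasoning
  closingRow≢1 .0 (suc p) p<β last≡ refl = <-irrefl refl (begin-strict
    β             <⟨ m<m+n β (s≤s z≤n) ⟩
    β + 2         ≤⟨ β+2≤n ⟩
    n             ≡⟨ trans n≡1+last (cong suc (trans last≡ (+-identityʳ (suc p)))) ⟩
    suc (suc p)   ≤⟨ p<β ⟩
    β             ∎)
    where open ≤-Reasoning

  L : ℕ
  L = closingRow (rowOf last) (pos last)

  open RowColouring (rowColouring L (closingRow≢1 (rowOf last) (pos last) (pos<β last) (decompose last)))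
    renaming (colour to x)

  Exit : ℕ → Set
  Exit i = suc (pos i) ≡ β ⊎ suc i ≡ n

  exit? : ∀ i → Dec (Exit i)
  exit? i = (suc (pos i) ≟ β) ⊎-dec (suc i ≟ n)

  column : ℕ → ℕ
  column i = rowColumn (x (rowOf i)) (x (suc (rowOf i))) (pos i) (exit? i)

  kind : ∀ i → RowKind (x (rowOf i)) (x (suc (rowOf i))) (pos i) (Exit i) (column i)
  kind i = rowKind _ _ (pos i) (exit? i)

  column-entry : ∀ {i} → pos i ≡ 0 → column i ≡ x (rowOf i)
  column-entry {i} p≡0 with kind i
  ... | entry _ c       = c
  ... | exit p≢0 _ _    = ⊥-elim (p≢0 p≡0)
  ... | second p≡1 _ _  = ⊥-elim (1+n≢0 (trans (sym p≡1) p≡0))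
  ... | middle 2≤p _ _  = ⊥-elim (1+n≢0 (n≤0⇒n≡0 (≤-trans (≤-trans (s≤s z≤n) 2≤p) (≤-reflexive p≡0))))

  column-exit : ∀ {i} → pos i ≢ 0 → Exit i → column i ≡ x (suc (rowOf i))
  column-exit {i} p≢0 e with kind i
  ... | entry p≡0 _   = ⊥-elim (p≢0 p≡0)
  ... | exit _ _ c    = c
  ... | second _ ¬e _ = ⊥-elim (¬e e)
  ... | middle _ ¬e _ = ⊥-elim (¬e e)

  end-of-row : ∀ {i j} → i < n → rowOf i ≡ rowOf j → suc (pos i) ≡ β → suc j ≡ n → i ≡ j
  end-of-row {i} {j} i<n r 1+pᵢ≡β 1+j≡n = index-unique r (≤-antisym pᵢ≤pⱼ pⱼ≤pᵢ)
    where
    open ≤-Reasoning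
    pⱼ≤pᵢ : pos j ≤ pos i
    pⱼ≤pᵢ = s≤s⁻¹ (subst (pos j <_) (sym 1+pᵢ≡β) (pos<β j))
    pᵢ≤pⱼ : pos i ≤ pos j
    pᵢ≤pⱼ = +-cancelʳ-≤ (rowOf j * β) (pos i) (pos j) (begin
      pos i + rowOf j * β   ≡⟨ cong (λ r → pos i + r * β) r ⟨
      pos i + rowOf i * β   ≡⟨ decompose i ⟨
      i                     ≤⟨ s≤s⁻¹ (subst (i <_) (sym 1+j≡n) i<n) ⟩
      j                     ≡⟨ decompose j ⟩
      pos j + rowOf j * β   ∎)

  exit-unique : ∀ {i j} → i < n → j < n → rowOf i ≡ rowOf j → Exit i → Exit j → i ≡ j
  exit-unique _   _   r (inj₁ eᵢ) (inj₁ eⱼ) = index-unique r (suc-injective (trans eᵢ (sym eⱼ)))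
  exit-unique _   _   _ (inj₂ eᵢ) (inj₂ eⱼ) = suc-injective (trans eᵢ (sym eⱼ))
  exit-unique i<n _   r (inj₁ eᵢ) (inj₂ eⱼ) = end-of-row i<n r eᵢ eⱼ
  exit-unique _   j<n r (inj₂ eᵢ) (inj₁ eⱼ) = sym (end-of-row j<n (sym r) eⱼ eᵢ)

  column<β : ∀ {i} → i < n → column i < β
  column<β {i} _ = rowColumn<β (colour≤2 _) (colour≤2 _) (proper _) (exit? i) 3≤β (pos<β i) inj₁

  separates : ∀ {i j} → i < n → j < n → rowOf i ≡ rowOf j → column i ≡ column j → i ≡ j
  separates {i} {j} i<n j<n r same
    with rowColumn-injective (colour≤2 _) (colour≤2 _) (proper (rowOf j)) (exit? i) (exit? j)
           (subst (λ r → rowColumn (x r) (x (suc r)) (pos i) (exit? i) ≡ column j) r same)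
  ... | inj₁ pᵢ≡pⱼ     = index-unique r pᵢ≡pⱼ
  ... | inj₂ (eᵢ , eⱼ) = exit-unique i<n j<n r eᵢ eⱼ

  turns : ∀ {i} → suc i < n → suc (pos i) ≡ β → column i ≡ column (suc i)
  turns {i} _ 1+p≡β = begin
    column i                 ≡⟨ column-exit p≢0 (inj₁ 1+p≡β) ⟩
    x (suc (rowOf i))        ≡⟨ cong x (sym (proj₁ next)) ⟩
    x (rowOf (suc i))        ≡⟨ column-entry (proj₂ next) ⟨
    column (suc i)           ∎
    where
    open ≡-Reasoning
    next : rowOf (suc i) ≡ suc (rowOf i) × pos (suc i) ≡ 0
    next = next-row {i} 1+p≡β
    p≢0 : pos i ≢ 0
    p≢0 p≡0 = contradiction (subst (3 ≤_) (trans (sym 1+p≡β) (cong suc p≡0)) 3≤β) λ { (s≤s ()) }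

  tour : RookTour α β n
  tour = rowMajorTour column n≤αβ column<β separates turns

  last-column : ∀ {p} → pos last ≡ p → column last ≡ x (closingRow (rowOf last) p)
  last-column {zero}  p≡ = column-entry p≡
  last-column {suc _} p≡ = column-exit (λ p≡0 → 1+n≢0 (trans (sym p≡) p≡0)) (inj₂ (sym n≡1+last))

  first-column : column 0 ≡ 0
  first-column = trans (column-entry (proj₂ origin)) (trans (cong x (proj₁ origin)) starts)

  closed : Closed tour
  closed = inj₂ (trans (last-column refl) (trans returns (sym first-column)))

star-symmetric : ∀ {n} → Symmetric (star n)
star-symmetric (inj₁ centre-leaf) = inj₂ centre-leaf
star-symmetric (inj₂ leaf-centre) = inj₁ leaf-centre

star-loopless : ∀ {n} → Loopless (star n)
star-loopless u (inj₁ (u≡0 , u≢0)) = u≢0 u≡0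
star-loopless u (inj₂ (u≡0 , u≢0)) = u≢0 u≡0

starEdges : ∀ m → EdgeList (star (suc m)) m
starEdges m = record { edge = λ e → zero , suc e ; joins = λ e → inj₁ (refl , λ ()) ; listed = listed }
  where
  listed : ∀ {u v} → star (suc m) u v → ∃ λ e → u ∈ₑ (zero , suc e) × v ∈ₑ (zero , suc e)
  listed {zero}  {zero}  (inj₁ (_ , v≢0)) = ⊥-elim (v≢0 refl)
  listed {zero}  {zero}  (inj₂ (_ , u≢0)) = ⊥-elim (u≢0 refl)
  listed {zero}  {suc e} _                = e , inj₁ refl , inj₂ refl
  listed {suc e} {zero}  _                = e , inj₂ refl , inj₁ refl
  listed {suc _} {suc _} (inj₁ (() , _))
  listed {suc _} {suc _} (inj₂ (() , _))

-- θ₁ = m: two distinct leaves are non-adjacent.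
starθ : ∀ m → IsIntersectionNumber (star (suc m)) m
starθ m = separated⇒θ₁ star-symmetric (starEdges m) λ {e} {e′} e≢e′ →
  suc e , suc e′ , inj₂ refl , inj₂ refl , e≢e′ ∘ fsuc-injective , λ { (inj₁ (() , _)) ; (inj₂ (() , _)) }

-- For m ≤ αβ the star has an (α | β)-CIR: the centre carries all features, and the leaves
-- carry distinct pairs (row , column) of the α × β board.
starCIR : ∀ {m α β} → m ≤ α * β → CIR (star (suc m)) α β
starCIR {m} {α} {β} m≤αβ = A , B , represents
  where
  position : Fin m → Fin α × Fin β
  position i = remQuot β (inject≤ i m≤αβ)

  position-injective : ∀ {i j} → position i ≡ position j → i ≡ j
  position-injective {i} {j} same = inject≤-injective m≤αβ m≤αβ i j (begin
    inject≤ i m≤αβ               ≡⟨ combine-remQuot {α} β _ ⟨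
    uncurry combine (position i) ≡⟨ cong (uncurry combine) same ⟩
    uncurry combine (position j) ≡⟨ combine-remQuot {α} β _ ⟩
    inject≤ j m≤αβ               ∎)
    where open ≡-Reasoning

  A : Fin (suc m) → Subset α
  A zero    = ⊤
  A (suc i) = ⁅ proj₁ (position i) ⁆

  B : Fin (suc m) → Subset β
  B zero    = ⊤
  B (suc i) = ⁅ proj₂ (position i) ⁆

  Share : Fin (suc m) → Fin (suc m) → Set
  Share = SharedFeatures A B

  centre-leaf : ∀ i → Share zero (suc i)
  centre-leaf i = (_ , ∈⊤ , x∈⁅x⁆ _) , (_ , ∈⊤ , x∈⁅x⁆ _)

  represents : ∀ u v → u ≢ v → (star (suc m) u v → Share u v) × (Share u v → star (suc m) u v)
  represents zero    zero    u≢v = ⊥-elim (u≢v refl)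
  represents zero    (suc i) _   = (λ _ → centre-leaf i) , (λ _ → inj₁ (refl , λ ()))
  represents (suc i) zero    _   = (λ _ → swap (centre-leaf i)) , (λ _ → inj₂ (refl , λ ()))
    where
    swap : Share zero (suc i) → Share (suc i) zero
    swap ((a , a₀ , aᵢ) , (b , b₀ , bᵢ)) = (a , aᵢ , a₀) , (b , bᵢ , b₀)
  represents (suc i) (suc j) u≢v =
    (λ { (inj₁ (() , _)) ; (inj₂ (() , _)) }) , λ share → ⊥-elim (u≢v (cong suc (leaves share)))
    where
    leaves : Share (suc i) (suc j) → i ≡ j
    leaves ((a , aᵢ , aⱼ) , (b , bᵢ , bⱼ)) = position-injective (×-≡,≡→≡
      (trans (sym (x∈⁅y⁆⇒x≡y _ aᵢ)) (x∈⁅y⁆⇒x≡y _ aⱼ) , trans (sym (x∈⁅y⁆⇒x≡y _ bᵢ)) (x∈⁅y⁆⇒x≡y _ bⱼ)))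

starBounds : ∀ n → 2 ≤ n → Bounds (star n)
starBounds (suc m) (s≤s 1≤m) = boundsBySplit 1≤m (starθ m) star-loopless λ _ s → starCIR (Split.t≤αβ s)

path-symmetric : ∀ {n} → Symmetric (path n)
path-symmetric (inj₁ v≡1+u) = inj₂ v≡1+u
path-symmetric (inj₂ u≡1+v) = inj₁ u≡1+v

path-loopless : ∀ {n} → Loopless (path n)
path-loopless u (inj₁ u≡1+u) = 1+n≢n (sym u≡1+u)
path-loopless u (inj₂ u≡1+u) = 1+n≢n (sym u≡1+u)

pathEdges : ∀ m → EdgeList (path (suc m)) m
pathEdges m = record { edge = λ e → inject₁ e , suc e ; joins = joins ; listed = listed }
  where
  joins : ∀ e → path (suc m) (inject₁ e) (suc e)
  joins e = inj₁ (cong suc (sym (toℕ-inject₁ e)))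

  listed→ : ∀ {u v} → toℕ v ≡ suc (toℕ u) → ∃ λ e → u ∈ₑ (inject₁ e , suc e) × v ∈ₑ (inject₁ e , suc e)
  listed→ {u} {suc e} v≡1+u = e , inj₁ (toℕ-injective (trans (toℕ-inject₁ e) (suc-injective v≡1+u))) , inj₂ refl

  listed : ∀ {u v} → path (suc m) u v → ∃ λ e → u ∈ₑ (inject₁ e , suc e) × v ∈ₑ (inject₁ e , suc e)
  listed (inj₁ v≡1+u) = listed→ v≡1+u
  listed (inj₂ u≡1+v) with listed→ u≡1+v
  ... | e , v∈e , u∈e = e , u∈e , v∈e

-- θ₁ = m: for e < e′, the ends e and e′ + 1 are at distance at least two.
pathθ : ∀ m → IsIntersectionNumber (path (suc m)) m
pathθ m = separated⇒θ₁ path-symmetric (pathEdges m) separated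
  where
  Sep : Fin m → Fin m → Set
  Sep = Separated path-symmetric (pathEdges m)

  separated< : ∀ {e e′} → toℕ e < toℕ e′ → Sep e e′
  separated< {e} {e′} e<e′ = inject₁ e , suc e′ , inj₁ refl , inj₂ refl , distinct , nonadjacent
    where
    a<b : toℕ (inject₁ e) < toℕ e′
    a<b = subst (_< toℕ e′) (sym (toℕ-inject₁ e)) e<e′
    distinct : inject₁ e ≢ suc e′
    distinct same = <⇒≢ (m<n⇒m<1+n a<b) (cong toℕ same)
    nonadjacent : ¬ path (suc m) (inject₁ e) (suc e′)
    nonadjacent (inj₁ b≡a) = <⇒≢ a<b (sym (suc-injective b≡a))
    nonadjacent (inj₂ a≡2+b) = <⇒≱ a<b (≤-trans (≤-trans (n≤1+n _) (n≤1+n _)) (≤-reflexive (sym a≡2+b)))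

  separated : ∀ {e e′} → e ≢ e′ → Sep e e′
  separated {e} {e′} e≢e′ with <-cmp (toℕ e) (toℕ e′)
  ... | tri< e<e′ _ _ = separated< e<e′
  ... | tri≈ _ e≡e′ _ = ⊥-elim (e≢e′ (toℕ-injective e≡e′))
  ... | tri> _ _ e′<e = separated-sym path-symmetric (pathEdges m) (separated< e′<e)

path-sharedEnd : ∀ {m} {e e′ : Fin m} {v} → v ∈ₑ (inject₁ e , suc e) → v ∈ₑ (inject₁ e′ , suc e′) →
                 toℕ e ≡ toℕ e′ ⊎ suc (toℕ e) ≡ toℕ e′ ⊎ suc (toℕ e′) ≡ toℕ e
path-sharedEnd {e = e} {e′} (inj₁ refl) (inj₁ same) =
  inj₁ (trans (sym (toℕ-inject₁ e)) (trans (cong toℕ (sym same)) (toℕ-inject₁ e′)))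
path-sharedEnd {e = e} (inj₁ refl) (inj₂ same) = inj₂ (inj₂ (trans (cong toℕ same) (toℕ-inject₁ e)))
path-sharedEnd {e′ = e′} (inj₂ refl) (inj₁ same) = inj₂ (inj₁ (trans (cong toℕ (sym same)) (toℕ-inject₁ e′)))
path-sharedEnd (inj₂ refl) (inj₂ same) = inj₁ (suc-injective (cong toℕ (sym same)))

-- A rook tour through m cells gives an (α | β)-CIR of the path on m + 1 vertices: its
-- i-th edge is placed on the i-th cell of the tour.
pathCIR : ∀ {α β m} → RookTour α β m → CIR (path (suc m)) α β
pathCIR {m = m} T = Placement.cir path-symmetric (pathEdges m) (cell ∘ toℕ) (λ e → onBoard (toℕ<n e))
                      (λ same → toℕ-injective (distinct (toℕ<n _) (toℕ<n _) same)) collinear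
  where
  open RookTour T

  consecutive : ∀ {i j} → suc i ≡ j → j < m → Collinear (cell i) (cell j)
  consecutive refl = step

  collinear : ∀ {v} {e e′ : Fin m} → v ∈ₑ (inject₁ e , suc e) → v ∈ₑ (inject₁ e′ , suc e′) →
              Collinear (cell (toℕ e)) (cell (toℕ e′))
  collinear {e = e} {e′} v∈e v∈e′ with path-sharedEnd v∈e v∈e′
  ... | inj₁ same        = subst (λ i → Collinear (cell (toℕ e)) (cell i)) same (collinear-refl _)
  ... | inj₂ (inj₁ next) = consecutive next (toℕ<n e′)
  ... | inj₂ (inj₂ prev) = collinear-sym (consecutive prev (toℕ<n e))

pathBounds : ∀ n → 2 ≤ n → Bounds (path n)
pathBounds (suc m) (s≤s 1≤m) = boundsBySplit 1≤m (pathθ m) path-loopless λ _ s →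
  let open Split s in pathCIR (RowMajor.snake β {{β-nonZero}} t≤αβ)

module CycleGraph (n : ℕ) .{{_ : NonZero n}} where

  next : ℕ → ℕ
  next a = suc a % n

  nextᶠ : Fin n → Fin n
  nextᶠ u = suc (toℕ u) mod n

  toℕ-nextᶠ : ∀ u → toℕ (nextᶠ u) ≡ next (toℕ u)
  toℕ-nextᶠ u = toℕ-fromℕ< _

  next-cases : ∀ {a} → a < n → (suc a < n × next a ≡ suc a) ⊎ (a ≡ n ∸ 1 × next a ≡ 0)
  next-cases {a} a<n with m≤n⇒m<n∨m≡n a<n
  ... | inj₁ 1+a<n = inj₁ (1+a<n , m<n⇒m%n≡m 1+a<n)
  ... | inj₂ 1+a≡n = inj₂ (cong (_∸ 1) 1+a≡n , trans (cong (_% n) 1+a≡n) (n%n≡0 n))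

  next-last : ∀ {a} → a ≡ n ∸ 1 → next a ≡ 0
  next-last refl = trans (cong (_% n) (m+[n∸m]≡n (>-nonZero⁻¹ n))) (n%n≡0 n)

  next-injective : ∀ {a b} → a < n → b < n → next a ≡ next b → a ≡ b
  next-injective a<n b<n same with next-cases a<n | next-cases b<n
  ... | inj₁ (_ , na) | inj₁ (_ , nb) = suc-injective (trans (sym na) (trans same nb))
  ... | inj₂ (a≡ , _) | inj₂ (b≡ , _) = trans a≡ (sym b≡)
  ... | inj₁ (_ , na) | inj₂ (_ , nb) = ⊥-elim (1+n≢0 (trans (sym na) (trans same nb)))
  ... | inj₂ (_ , na) | inj₁ (_ , nb) = ⊥-elim (1+n≢0 (trans (sym nb) (trans (sym same) na)))

  next-mod : ∀ x → next (x % n) ≡ next x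
  next-mod x = begin
    (1 + x % n) % n               ≡⟨ %-distribˡ-+ 1 (x % n) n ⟩
    (1 % n + x % n % n) % n       ≡⟨ cong (λ y → (1 % n + y) % n) (m%n%n≡m%n x n) ⟩
    (1 % n + x % n) % n           ≡⟨ %-distribˡ-+ 1 x n ⟨
    (1 + x) % n                   ∎
    where open ≡-Reasoning

  rotation-free : ∀ {k} → 0 < k → k < n → ∀ a → (k + a) % n ≢ a
  rotation-free {k} 0<k k<n a same = multiple ((k + a) / n) k≡qn
    where
    open ≡-Reasoning
    k≡qn : k ≡ (k + a) / n * n
    k≡qn = +-cancelʳ-≡ a k _ (begin
      k + a                         ≡⟨ m≡m%n+[m/n]*n (k + a) n ⟩
      (k + a) % n + (k + a) / n * n ≡⟨ cong (_+ (k + a) / n * n) same ⟩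
      a + (k + a) / n * n           ≡⟨ +-comm a _ ⟩
      (k + a) / n * n + a           ∎)
    multiple : ∀ q → k ≢ q * n
    multiple zero    k≡0  = <⇒≢ 0<k (sym k≡0)
    multiple (suc q) k≡qn = <⇒≱ k<n (subst (n ≤_) (sym k≡qn) (m≤m+n n (q * n)))

  nextᶠ-moves : 2 ≤ n → ∀ u → nextᶠ u ≢ u
  nextᶠ-moves 2≤n u same = rotation-free (s≤s z≤n) 2≤n (toℕ u) (trans (sym (toℕ-nextᶠ u)) (cong toℕ same))

  nextᶠ²-moves : 3 ≤ n → ∀ u → nextᶠ (nextᶠ u) ≢ u
  nextᶠ²-moves 3≤n u same = rotation-free (s≤s z≤n) 3≤n (toℕ u) (begin
    (2 + toℕ u) % n               ≡⟨ next-mod (suc (toℕ u)) ⟨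
    next (next (toℕ u))           ≡⟨ cong next (toℕ-nextᶠ u) ⟨
    next (toℕ (nextᶠ u))          ≡⟨ toℕ-nextᶠ (nextᶠ u) ⟨
    toℕ (nextᶠ (nextᶠ u))         ≡⟨ cong toℕ same ⟩
    toℕ u                         ∎)
    where open ≡-Reasoning

  nextᶠ³-moves : 4 ≤ n → ∀ u → nextᶠ (nextᶠ (nextᶠ u)) ≢ u
  nextᶠ³-moves 4≤n u same = rotation-free (s≤s z≤n) 4≤n (toℕ u) (begin
    (3 + toℕ u) % n               ≡⟨ next-mod (suc (suc (toℕ u))) ⟨
    next (next (suc (toℕ u)))     ≡⟨ cong next (next-mod (suc (toℕ u))) ⟨
    next (next (next (toℕ u)))    ≡⟨ cong (next ∘ next) (toℕ-nextᶠ u) ⟨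
    next (next (toℕ (nextᶠ u)))   ≡⟨ cong next (toℕ-nextᶠ (nextᶠ u)) ⟨
    next (toℕ (nextᶠ (nextᶠ u)))  ≡⟨ toℕ-nextᶠ (nextᶠ (nextᶠ u)) ⟨
    toℕ (nextᶠ (nextᶠ (nextᶠ u))) ≡⟨ cong toℕ same ⟩
    toℕ u                         ∎)
    where open ≡-Reasoning

  nextᶠ-injective : ∀ {u v} → nextᶠ u ≡ nextᶠ v → u ≡ v
  nextᶠ-injective {u} {v} same = toℕ-injective (next-injective (toℕ<n u) (toℕ<n v)
    (trans (sym (toℕ-nextᶠ u)) (trans (cong toℕ same) (toℕ-nextᶠ v))))

  cycle-next : ∀ u → cycle n u (nextᶠ u)
  cycle-next u with next-cases (toℕ<n u)
  ... | inj₁ (_ , next≡1+u)    = inj₁ (inj₁ (trans (toℕ-nextᶠ u) next≡1+u))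
  ... | inj₂ (u≡last , next≡0) = inj₂ (inj₂ (trans (toℕ-nextᶠ u) next≡0 , u≡last))

  follows : ∀ {u v} → toℕ v ≡ suc (toℕ u) → v ≡ nextᶠ u
  follows {u} {v} v≡1+u = toℕ-injective (trans v≡1+u (sym (trans (toℕ-nextᶠ u) (m<n⇒m%n≡m 1+u<n))))
    where
    1+u<n : suc (toℕ u) < n
    1+u<n = subst (_< n) v≡1+u (toℕ<n v)

  cycle⇒next : ∀ {u v} → cycle n u v → v ≡ nextᶠ u ⊎ u ≡ nextᶠ v
  cycle⇒next (inj₁ (inj₁ v≡1+u)) = inj₁ (follows v≡1+u)
  cycle⇒next (inj₁ (inj₂ u≡1+v)) = inj₂ (follows u≡1+v)
  cycle⇒next {u} {v} (inj₂ (inj₁ (u≡0 , v≡last))) =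
    inj₂ (toℕ-injective (trans u≡0 (sym (trans (toℕ-nextᶠ v) (next-last v≡last)))))
  cycle⇒next {u} {v} (inj₂ (inj₂ (v≡0 , u≡last))) =
    inj₁ (toℕ-injective (trans v≡0 (sym (trans (toℕ-nextᶠ u) (next-last u≡last)))))

  cycle-symmetric : Symmetric (cycle n)
  cycle-symmetric (inj₁ p)        = inj₁ (path-symmetric p)
  cycle-symmetric (inj₂ (inj₁ w)) = inj₂ (inj₂ w)
  cycle-symmetric (inj₂ (inj₂ w)) = inj₂ (inj₁ w)

  cycle-loopless : 3 ≤ n → Loopless (cycle n)
  cycle-loopless _   u (inj₁ p)                 = path-loopless u p
  cycle-loopless 3≤n u (inj₂ (inj₁ (u≡0 , u≡last))) = last≢0 3≤n (trans (sym u≡last) u≡0)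
    where
    last≢0 : ∀ {n} → 3 ≤ n → n ∸ 1 ≢ 0
    last≢0 (s≤s (s≤s (s≤s _))) ()
  cycle-loopless 3≤n u (inj₂ (inj₂ (u≡0 , u≡last))) = cycle-loopless 3≤n u (inj₂ (inj₁ (u≡0 , u≡last)))

  cycleEdges : EdgeList (cycle n) n
  cycleEdges = record { edge = λ u → u , nextᶠ u ; joins = cycle-next ; listed = listed }
    where
    listed : ∀ {u v} → cycle n u v → ∃ λ e → u ∈ₑ (e , nextᶠ e) × v ∈ₑ (e , nextᶠ e)
    listed {u} {v} uv with cycle⇒next uv
    ... | inj₁ v≡ = u , inj₁ refl , inj₂ (sym v≡)
    ... | inj₂ u≡ = v , inj₂ (sym u≡) , inj₁ refl

  -- θ₁ = n for n ≥ 4: two consecutive edges u, u + 1 are separated by the ends u and u + 2,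
  -- and two non-consecutive distinct edges by their first ends.
  cycleθ : 4 ≤ n → IsIntersectionNumber (cycle n) n
  cycleθ 4≤n = separated⇒θ₁ cycle-symmetric cycleEdges separated
    where
    Sep : Fin n → Fin n → Set
    Sep = Separated cycle-symmetric cycleEdges
    3≤n : 3 ≤ n
    3≤n = ≤-trans (n≤1+n 3) 4≤n
    2≤n : 2 ≤ n
    2≤n = ≤-trans (n≤1+n 2) 3≤n

    consecutive : ∀ u → Sep u (nextᶠ u)
    consecutive u = u , nextᶠ (nextᶠ u) , inj₁ refl , inj₂ refl , (nextᶠ²-moves 3≤n u ∘ sym) , nonadjacent
      where
      nonadjacent : ¬ cycle n u (nextᶠ (nextᶠ u))
      nonadjacent uw with cycle⇒next uw
      ... | inj₁ w≡ = nextᶠ-moves 2≤n u (nextᶠ-injective w≡)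
      ... | inj₂ u≡ = nextᶠ³-moves 4≤n u (sym u≡)

    separated : ∀ {e e′} → e ≢ e′ → Sep e e′
    separated {e} {e′} e≢e′ with e′ ≟ᶠ nextᶠ e | e ≟ᶠ nextᶠ e′
    ... | yes refl | _        = consecutive e
    ... | no _     | yes refl = separated-sym cycle-symmetric cycleEdges (consecutive e′)
    ... | no e′≢   | no e≢    = e , e′ , inj₁ refl , inj₁ refl , e≢e′ , λ ee′ → [ e′≢ , e≢ ] (cycle⇒next ee′)

  cycle-sharedEnd : ∀ {e e′ v} → v ∈ₑ (e , nextᶠ e) → v ∈ₑ (e′ , nextᶠ e′) → e ≡ e′ ⊎ e′ ≡ nextᶠ e ⊎ e ≡ nextᶠ e′
  cycle-sharedEnd (inj₁ refl) (inj₁ same) = inj₁ (sym same)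
  cycle-sharedEnd (inj₁ refl) (inj₂ same) = inj₂ (inj₂ (sym same))
  cycle-sharedEnd (inj₂ refl) (inj₁ same) = inj₂ (inj₁ same)
  cycle-sharedEnd (inj₂ refl) (inj₂ same) = inj₁ (nextᶠ-injective (sym same))

  cycleCIR : ∀ {α β} (T : RookTour α β n) → Closed T → CIR (cycle n) α β
  cycleCIR T closed = Placement.cir cycle-symmetric cycleEdges (cell ∘ toℕ) (λ e → onBoard (toℕ<n e))
                        (λ same → toℕ-injective (distinct (toℕ<n _) (toℕ<n _) same)) collinear
    where
    open RookTour T
    tour-next : ∀ u → Collinear (cell (toℕ u)) (cell (toℕ (nextᶠ u)))
    tour-next u rewrite toℕ-nextᶠ u with next-cases (toℕ<n u)
    ... | inj₁ (1+u<n , next≡) rewrite next≡ = step 1+u<n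
    ... | inj₂ (u≡last , next≡) rewrite next≡ | u≡last = closed

    collinear : ∀ {v e e′} → v ∈ₑ (e , nextᶠ e) → v ∈ₑ (e′ , nextᶠ e′) → Collinear (cell (toℕ e)) (cell (toℕ e′))
    collinear v∈e v∈e′ with cycle-sharedEnd v∈e v∈e′
    ... | inj₁ refl        = collinear-refl _
    ... | inj₂ (inj₁ refl) = tour-next _
    ... | inj₂ (inj₂ refl) = collinear-sym (tour-next _)

-- The triangle is complete: a single clique covers it, and giving every vertex all
-- features is a CIR of any size.
triangle-complete : ∀ u v → u ≢ v → cycle 3 u v
triangle-complete zero                zero                u≢v = ⊥-elim (u≢v refl)
triangle-complete zero                (suc zero)          _   = inj₁ (inj₁ refl)
triangle-complete zero                (suc (suc zero))    _   = inj₂ (inj₁ (refl , refl))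
triangle-complete (suc zero)          zero                _   = inj₁ (inj₂ refl)
triangle-complete (suc zero)          (suc zero)          u≢v = ⊥-elim (u≢v refl)
triangle-complete (suc zero)          (suc (suc zero))    _   = inj₁ (inj₁ refl)
triangle-complete (suc (suc zero))    zero                _   = inj₂ (inj₂ (refl , refl))
triangle-complete (suc (suc zero))    (suc zero)          _   = inj₁ (inj₂ refl)
triangle-complete (suc (suc zero))    (suc (suc zero))    u≢v = ⊥-elim (u≢v refl)

triangleθ : IsIntersectionNumber (cycle 3) 1
triangleθ = ((λ _ → ⊤) , (λ _ u v _ _ → triangle-complete u v) , (λ u v _ → zero , ∈⊤ , ∈⊤)) ,
            (λ k (_ , _ , covers) → nonempty (proj₁ (covers zero (suc zero) (inj₁ (inj₁ refl)))))
  where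
  nonempty : ∀ {k} → Fin k → 1 ≤ k
  nonempty {suc _} _ = s≤s z≤n

triangleCIR : ∀ {α β} → 1 ≤ α → 1 ≤ β → CIR (cycle 3) α β
triangleCIR (s≤s _) (s≤s _) = (λ _ → ⊤) , (λ _ → ⊤) , λ u v u≢v →
  (λ _ → (zero , ∈⊤ , ∈⊤) , (zero , ∈⊤ , ∈⊤)) , (λ _ → triangle-complete u v u≢v)

cycleBounds : ∀ n → 3 ≤ n → Bounds (cycle n)
cycleBounds 1 (s≤s ())
cycleBounds 2 (s≤s (s≤s ()))
cycleBounds 3 _ = boundsBySplit ≤-refl triangleθ (cycle-loopless ≤-refl) λ _ s →
  triangleCIR (Split.1≤α s) (Split.1≤β s)
  where open CycleGraph 3
-- For the 4-cycle, ⌈2√4⌉ = 4 and the square tour on the 2 × 2 board gives a CIR.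
cycleBounds 4 _ = bounds (cycleθ ≤-refl) (cycle-loopless (n≤1+n 3)) construct
  where
  open CycleGraph 4
  construct : ∀ {k} → IsCeilTwoSqrt 4 k → HasCIRSize (cycle 4) k
  construct {k} (16≤k² , minimal) =
    subst (HasCIRSize (cycle 4)) (sym k≡4)
          (2 , 2 , s≤s z≤n , s≤s z≤n , refl , cycleCIR (proj₁ squareTour) (proj₂ squareTour))
    where
    k≡4 : k ≡ 4
    k≡4 = ≤-antisym (minimal 4 ≤-refl) (≮⇒≥ λ k<4 →
            contradiction (≤-trans 16≤k² (*-mono-≤ (s≤s⁻¹ k<4) (s≤s⁻¹ k<4))) (from-no (16 ≤? 9)))
cycleBounds n@(suc (suc (suc (suc (suc _))))) _ =
  boundsBySplit (s≤s z≤n) (cycleθ 4≤n) (cycle-loopless 3≤n) represent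
  where
  open CycleGraph n
  4≤n : 4 ≤ n
  4≤n = s≤s (s≤s (s≤s (s≤s z≤n)))
  3≤n : 3 ≤ n
  3≤n = ≤-trans (n≤1+n 3) 4≤n
  represent : ∀ {k} → IsCeilTwoSqrt n k → (s : Split n k) → CIR (cycle n) (Split.α s) (Split.β s)
  represent ceil s = cycleCIR tour closed
    where
    open Split s
    shape : 3 ≤ β × β + 2 ≤ n
    shape = cycleSplit (s≤s (s≤s (s≤s (s≤s (s≤s z≤n))))) ceil α≤β β≤1+α α+β≡k
    open ClosedTour α β n {{β-nonZero}} (proj₁ shape) (proj₂ shape) t≤αβ

corollary2 : ((n : ℕ) → 2 ≤ n → Bounds (star n))
           × ((n : ℕ) → 2 ≤ n → Bounds (path n))
           × ((n : ℕ) → 3 ≤ n → Bounds (cycle n))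
corollary2 = starBounds , pathBounds , cycleBounds
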